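{- Let $\mathbb{Z}[i]=\{a+bi:\ a,b\in\mathbb{Z}\}$ be the ring of Gaussian integers. A number $z\in\mathbb{Z}[i]$ is a rational integer (i.e., $z\in\mathbb{Z}$) if and only if there exist $v,w,x,y\in\mathbb{Z}[i]$ with $v\neq 0$ such that $$\bigl(4(2v(2(2z+1)^2+1)-y)^2-3y^2-1\bigr)^2+2\bigl(w^2-1-3y^2(2z+1-xy)^2\bigr)^2=0.$$ -}

module Defs where

open import Data.Integer as ℤ using (ℤ; +_)
open import Data.Product using (∃-syntax)
open import Relation.Binary.PropositionalEquality using (_≡_)

record ℤ[i] : Set where
  constructor _+_i
  field
    re : ℤ
    im : ℤ
open ℤ[i] public

infixl 6 _⊕_ _⊖_
infixl 7 _⊛_

_⊕_ : ℤ[i] → ℤ[i] → ℤ[i]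
(a + b i) ⊕ (c + d i) = (a ℤ.+ c) + (b ℤ.+ d) i

_⊖_ : ℤ[i] → ℤ[i] → ℤ[i]
(a + b i) ⊖ (c + d i) = (a ℤ.- c) + (b ℤ.- d) i

_⊛_ : ℤ[i] → ℤ[i] → ℤ[i]
(a + b i) ⊛ (c + d i) = (a ℤ.* c ℤ.- b ℤ.* d) + (a ℤ.* d ℤ.+ b ℤ.* c) i

ι : ℤ → ℤ[i]
ι n = n + (+ 0) i

0ᵍ 1ᵍ : ℤ[i]
0ᵍ = ι (+ 0)
1ᵍ = ι (+ 1)

lit : ℤ → ℤ[i]
lit = ι

sq : ℤ[i] → ℤ[i]
sq z = z ⊛ z

IsRationalInteger : ℤ[i] → Set
IsRationalInteger z = ∃[ n ] z ≡ ι n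

P : ℤ[i] → ℤ[i] → ℤ[i] → ℤ[i] → ℤ[i] → ℤ[i]
P z v w x y =
  sq (lit (+ 4) ⊛ sq (lit (+ 2) ⊛ v ⊛ (lit (+ 2) ⊛ sq (lit (+ 2) ⊛ z ⊕ 1ᵍ) ⊕ 1ᵍ) ⊖ y)
      ⊖ lit (+ 3) ⊛ sq y ⊖ 1ᵍ)
  ⊕ lit (+ 2) ⊛ sq (sq w ⊖ 1ᵍ ⊖ lit (+ 3) ⊛ sq y ⊛ sq (lit (+ 2) ⊛ z ⊕ 1ᵍ ⊖ x ⊛ y))

-- Write P = A² + 2B² with M = 2(2z + 1)² + 1, A = 4(2vM − y)² − 3y² − 1 and
-- B = w² − 1 − 3y²(2z + 1 − xy)².  In ℤ[i], A² + 2B² = 0 forces A = B = 0, and every Gaussian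
-- solution of u² − 3w² = 1 is rational: comparing u² − 3w² with ∣u∣² − 3∣w∣² reduces this to the
-- irrationality of √3 and to −1 not being a square mod 3.  So y = r and 2vM − y = p are integers with
-- 4p² = 3r² + 1, and Im(2z + 1) = r · Im x.  Then 2vM = p + r is a nonzero rational multiple of M, so
-- ∣Im M∣ ≤ ∣p + r∣ ≤ 2∣r∣; but ∣Im M∣ = 4∣Re(2z + 1)∣ ∣Im(2z + 1)∣ ≥ 4∣r∣ unless Im z = 0.
-- Conversely, for z = a ∈ ℤ, the unit ε = 2 + √3 has finite order modulo 4M, so some odd power
-- X + Y√3 of ε is ≡ 2 + √3 mod 4M; then y = −Y and v = (X − 2Y)/4M ≠ 0 solve A = 0.  Since
-- (X + Y√3)ᵏ ≡ X + kY√3 mod Y² for odd k, the power k = ∣2a + 1∣ yields w and x solving B = 0.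

module Submission where

open import Defs
open import Data.Empty using (⊥-elim)
open import Data.Fin.Base using (Fin; toℕ; fromℕ<; combine)
open import Data.Fin.Properties using (toℕ-fromℕ<; combine-injective; pigeonhole)
open import Data.Integer as ℤ using (ℤ; +_; -[1+_]; _+_; _*_; _-_; -_; ∣_∣)
open import Data.Integer.DivMod using (_%ℕ_; _/ℕ_; n%ℕd<d; a≡a%ℕn+[a/ℕn]*n)
open import Data.Integer.Divisibility.Signed
  using (_∣_; divides; ∣-trans; m∣∣m∣; ∣m∣n⇒∣m+n; ∣m⇒∣-m; ∣m⇒∣m*n; ∣n⇒∣m*n)
import Data.Integer.Properties as ℤP
open import Data.Integer.Tactic.RingSolver using (solve; solve-∀)
open import Data.List.Base using (_∷_; [])
open import Data.Nat as ℕ using (ℕ; zero; suc; NonZero; z≤n; s≤s)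
import Data.Nat.Divisibility as ℕ∣
open import Data.Nat.DivMod using (_%_; [m+kn]%n≡m%n; m*n%n≡0)
open import Data.Nat.Induction using (<-rec)
open import Data.Nat.Primality using (Prime; euclidsLemma; prime⇒nonZero; prime⇒nonTrivial; prime[2]; prime?)
import Data.Nat.Properties as ℕP
import Data.Nat.Tactic.RingSolver as ℕ-Solver
open import Data.Product using (_×_; _,_; proj₁; proj₂; ∃-syntax)
open import Data.Sum using (_⊎_; inj₁; inj₂)
open import Function.Base using (_∘′_)
open import Function.Bundles using (_⇔_; mk⇔)
open import Level using (0ℓ)
open import Relation.Binary.Bundles using (Setoid)
open import Relation.Binary.PropositionalEquality
import Relation.Binary.Reasoning.Setoid as SetoidReasoning
open import Relation.Nullary using (yes; no)
open import Relation.Nullary.Decidable using (from-yes)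

i*i≡+∣i∣*∣i∣ : ∀ i → i * i ≡ + (∣ i ∣ ℕ.* ∣ i ∣)
i*i≡+∣i∣*∣i∣ (+ n)    = sym (ℤP.pos-* n n)
i*i≡+∣i∣*∣i∣ -[1+ n ] = refl

m*m≡0⇒m≡0 : ∀ {m} → m ℕ.* m ≡ 0 → m ≡ 0
m*m≡0⇒m≡0 {zero} _ = refl

m*m≤n*n⇒m≤n : ∀ {m n} → m ℕ.* m ℕ.≤ n ℕ.* n → m ℕ.≤ n
m*m≤n*n⇒m≤n {m} {n} m²≤n² with m ℕ.≤? n
... | yes m≤n = m≤n
... | no  m≰n = let n<m = ℕP.≰⇒> m≰n in ⊥-elim (ℕP.<⇒≱ (ℕP.*-mono-< n<m n<m) m²≤n²)

i≡i-j+j : ∀ i j → i ≡ i - j + j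
i≡i-j+j = solve-∀

2*i≡0⇒i≡0 : ∀ {i} → + 2 * i ≡ + 0 → i ≡ + 0
2*i≡0⇒i≡0 {i} 2i≡0 with ℤP.i*j≡0⇒i≡0∨j≡0 (+ 2) 2i≡0
... | inj₂ i≡0 = i≡0

2j+1≢0 : ∀ j → + 2 * j + + 1 ≢ + 0
2j+1≢0 j 2j+1≡0 with () ← ℕP.m*n≡1⇒m≡1 2 ∣ j ∣
  (trans (sym (ℤP.abs-* (+ 2) j)) (cong ∣_∣ (ℤP.i-j≡0⇒i≡j (+ 2 * j) (- + 1) 2j+1≡0)))

4j≢1 : ∀ j → + 4 * j ≢ + 1
4j≢1 j 4j≡1 with () ← ℕP.m*n≡1⇒m≡1 4 ∣ j ∣ (trans (sym (ℤP.abs-* (+ 4) j)) (cong ∣_∣ 4j≡1))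

sq-of-multiple : ∀ k p → k ℕ.* p ℕ.* (k ℕ.* p) ≡ p ℕ.* (p ℕ.* (k ℕ.* k))
sq-of-multiple = ℕ-Solver.solve-∀

module _ {p : ℕ} (p-prime : Prime p) where

  private instance
    p≢0 : NonZero p
    p≢0 = prime⇒nonZero p-prime

  prime∣sq⇒∣ : ∀ m q → m ℕ.* m ≡ q ℕ.* p → ∃[ k ] m ≡ k ℕ.* p
  prime∣sq⇒∣ m q m²≡qp with euclidsLemma m m p-prime (ℕ∣.divides q m²≡qp)
  ... | inj₁ (ℕ∣.divides k m≡kp) = k , m≡kp
  ... | inj₂ (ℕ∣.divides k m≡kp) = k , m≡kp

  quotient< : ∀ k {m} → suc m ≡ k ℕ.* p → k ℕ.< suc m
  quotient< zero    _      = s≤s z≤n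
  quotient< (suc k) m≡kp = subst (suc k ℕ.<_) (sym m≡kp)
    (ℕP.m<m*n (suc k) p (ℕ.nonTrivial⇒n>1 p {{prime⇒nonTrivial p-prime}}))

  -- If m = kp then p ∣ n, say n = jp, and k² = p j² with k < m.
  sq≡prime*sq⇒≡0 : ∀ m n → m ℕ.* m ≡ p ℕ.* (n ℕ.* n) → m ≡ 0
  sq≡prime*sq⇒≡0 = <-rec _ descent
    where
    descent : ∀ m → (∀ {k} → k ℕ.< m → ∀ n → k ℕ.* k ≡ p ℕ.* (n ℕ.* n) → k ≡ 0) →
              ∀ n → m ℕ.* m ≡ p ℕ.* (n ℕ.* n) → m ≡ 0
    descent zero    _   _ _ = refl
    descent (suc m) rec n m²≡pn²
      with k , m≡kp ← prime∣sq⇒∣ (suc m) (n ℕ.* n) (trans m²≡pn² (ℕP.*-comm p _))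
      with pk²≡n² ← ℕP.*-cancelˡ-≡ (p ℕ.* (k ℕ.* k)) (n ℕ.* n) p
                      (trans (sym (sq-of-multiple k p)) (trans (cong (λ t → t ℕ.* t) (sym m≡kp)) m²≡pn²))
      with j , n≡jp ← prime∣sq⇒∣ n (k ℕ.* k) (trans (sym pk²≡n²) (ℕP.*-comm p _))
      = trans m≡kp (cong (ℕ._* p) (rec (quotient< k m≡kp) j k²≡pj²))
      where
      k²≡pj² : k ℕ.* k ≡ p ℕ.* (j ℕ.* j)
      k²≡pj² = ℕP.*-cancelˡ-≡ (k ℕ.* k) (p ℕ.* (j ℕ.* j)) p
        (trans pk²≡n² (trans (cong (λ t → t ℕ.* t) n≡jp) (sq-of-multiple j p)))

  sq≡prime*sq⇒≡0ℤ : ∀ {a b} → a * a ≡ + p * (b * b) → a ≡ + 0 × b ≡ + 0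
  sq≡prime*sq⇒≡0ℤ {a} {b} a²≡pb² = ℤP.∣i∣≡0⇒i≡0 ∣a∣≡0 , ℤP.∣i∣≡0⇒i≡0 (m*m≡0⇒m≡0 ∣b∣²≡0)
    where
    open ≡-Reasoning
    ∣a∣²≡p∣b∣² : ∣ a ∣ ℕ.* ∣ a ∣ ≡ p ℕ.* (∣ b ∣ ℕ.* ∣ b ∣)
    ∣a∣²≡p∣b∣² = ℤP.+-injective (begin
      + (∣ a ∣ ℕ.* ∣ a ∣)          ≡⟨ i*i≡+∣i∣*∣i∣ a ⟨
      a * a                        ≡⟨ a²≡pb² ⟩
      + p * (b * b)                ≡⟨ cong (+ p *_) (i*i≡+∣i∣*∣i∣ b) ⟩
      + p * + (∣ b ∣ ℕ.* ∣ b ∣)    ≡⟨ ℤP.pos-* p (∣ b ∣ ℕ.* ∣ b ∣) ⟨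
      + (p ℕ.* (∣ b ∣ ℕ.* ∣ b ∣))  ∎)
    ∣a∣≡0 : ∣ a ∣ ≡ 0
    ∣a∣≡0 = sq≡prime*sq⇒≡0 ∣ a ∣ ∣ b ∣ ∣a∣²≡p∣b∣²
    ∣b∣²≡0 : ∣ b ∣ ℕ.* ∣ b ∣ ≡ 0
    ∣b∣²≡0 = ℕP.*-cancelˡ-≡ (∣ b ∣ ℕ.* ∣ b ∣) 0 p (begin
      p ℕ.* (∣ b ∣ ℕ.* ∣ b ∣)  ≡⟨ ∣a∣²≡p∣b∣² ⟨
      ∣ a ∣ ℕ.* ∣ a ∣          ≡⟨ cong (λ t → t ℕ.* t) ∣a∣≡0 ⟩
      0                        ≡⟨ ℕP.*-zeroʳ p ⟨
      p ℕ.* 0                  ∎)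

prime[3] : Prime 3
prime[3] = from-yes (prime? 3)

sq+1%3≢0 : ∀ m → (m ℕ.* m ℕ.+ 1) % 3 ≢ 0
sq+1%3≢0 0 ()
sq+1%3≢0 1 ()
sq+1%3≢0 2 ()
sq+1%3≢0 (suc (suc (suc m))) eq =
  sq+1%3≢0 m (trans (sym ([m+kn]%n≡m%n (m ℕ.* m ℕ.+ 1) (2 ℕ.* m ℕ.+ 3) 3)) (trans (cong (_% 3) (shift m)) eq))
  where
  shift : ∀ m → m ℕ.* m ℕ.+ 1 ℕ.+ (2 ℕ.* m ℕ.+ 3) ℕ.* 3 ≡ (3 ℕ.+ m) ℕ.* (3 ℕ.+ m) ℕ.+ 1
  shift = ℕ-Solver.solve-∀

3*sq-sq≢1 : ∀ b d → + 3 * (d * d) - b * b ≢ + 1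
3*sq-sq≢1 b d eq = sq+1%3≢0 ∣ b ∣ (begin
  (∣ b ∣ ℕ.* ∣ b ∣ ℕ.+ 1) % 3   ≡⟨ cong (_% 3) (ℤP.+-injective (begin
      + (∣ b ∣ ℕ.* ∣ b ∣) + + 1         ≡⟨ cong (_+ + 1) (i*i≡+∣i∣*∣i∣ b) ⟨
      b * b + + 1                      ≡⟨ cong (λ t → b * b + t) eq ⟨
      b * b + (+ 3 * (d * d) - b * b)  ≡⟨ solve (b ∷ d ∷ []) ⟩
      + 3 * (d * d)                    ≡⟨ cong (+ 3 *_) (i*i≡+∣i∣*∣i∣ d) ⟩
      + 3 * + (∣ d ∣ ℕ.* ∣ d ∣)          ≡⟨ ℤP.pos-* 3 (∣ d ∣ ℕ.* ∣ d ∣) ⟨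
      + (3 ℕ.* (∣ d ∣ ℕ.* ∣ d ∣))        ∎)) ⟩
  (3 ℕ.* (∣ d ∣ ℕ.* ∣ d ∣)) % 3  ≡⟨ cong (_% 3) (ℕP.*-comm 3 (∣ d ∣ ℕ.* ∣ d ∣)) ⟩
  (∣ d ∣ ℕ.* ∣ d ∣ ℕ.* 3) % 3    ≡⟨ m*n%n≡0 (∣ d ∣ ℕ.* ∣ d ∣) 3 ⟩
  0                            ∎)
  where open ≡-Reasoning

m+c*n²≡t≤1⇒m≡t : ∀ m n {c t} → 2 ℕ.≤ c → t ℕ.≤ 1 → m ℕ.+ c ℕ.* (n ℕ.* n) ≡ t → m ≡ t
m+c*n²≡t≤1⇒m≡t m zero    {c} _   _   eq = trans (sym (trans (cong (m ℕ.+_) (ℕP.*-zeroʳ c)) (ℕP.+-identityʳ m))) eq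
m+c*n²≡t≤1⇒m≡t m (suc n) {c} 2≤c t≤1 refl = ⊥-elim (ℕP.<-irrefl refl (begin-strict
  1                              <⟨ s≤s (s≤s z≤n) ⟩
  2                              ≤⟨ ℕP.m≤m*n 2 (suc n ℕ.* suc n) ⟩
  2 ℕ.* (suc n ℕ.* suc n)        ≤⟨ ℕP.*-monoˡ-≤ (suc n ℕ.* suc n) 2≤c ⟩
  c ℕ.* (suc n ℕ.* suc n)        ≤⟨ ℕP.m≤n+m (c ℕ.* (suc n ℕ.* suc n)) m ⟩
  m ℕ.+ c ℕ.* (suc n ℕ.* suc n)  ≤⟨ t≤1 ⟩
  1                              ∎))
  where open ℕP.≤-Reasoning

sq+c*sq≡t≤1⇒ : ∀ {i j c t} → 2 ℕ.≤ c → t ℕ.≤ 1 → i * i + + c * (j * j) ≡ + t → ∣ i ∣ ℕ.* ∣ i ∣ ≡ t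
sq+c*sq≡t≤1⇒ {i} {j} {c} {t} 2≤c t≤1 eq = m+c*n²≡t≤1⇒m≡t (∣ i ∣ ℕ.* ∣ i ∣) ∣ j ∣ 2≤c t≤1 (ℤP.+-injective (begin
  + (∣ i ∣ ℕ.* ∣ i ∣) + + (c ℕ.* (∣ j ∣ ℕ.* ∣ j ∣))  ≡⟨ cong (λ v → + (∣ i ∣ ℕ.* ∣ i ∣) + v) (ℤP.pos-* c (∣ j ∣ ℕ.* ∣ j ∣)) ⟩
  + (∣ i ∣ ℕ.* ∣ i ∣) + + c * + (∣ j ∣ ℕ.* ∣ j ∣)    ≡⟨ cong₂ (λ u v → u + + c * v) (i*i≡+∣i∣*∣i∣ i) (i*i≡+∣i∣*∣i∣ j) ⟨
  i * i + + c * (j * j)                              ≡⟨ eq ⟩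
  + t                                                ∎))
  where open ≡-Reasoning

4P²≡1+3R²⇒P≤R : ∀ P R → 4 ℕ.* (P ℕ.* P) ≡ 1 ℕ.+ 3 ℕ.* (R ℕ.* R) → P ℕ.≤ R
4P²≡1+3R²⇒P≤R P zero eq with () ← ℕP.m*n≡1⇒m≡1 4 (P ℕ.* P) eq
4P²≡1+3R²⇒P≤R P R@(suc _) eq = m*m≤n*n⇒m≤n (ℕP.*-cancelˡ-≤ 4 (begin
  4 ℕ.* (P ℕ.* P)             ≡⟨ eq ⟩
  1 ℕ.+ 3 ℕ.* (R ℕ.* R)        ≤⟨ ℕP.+-monoˡ-≤ (3 ℕ.* (R ℕ.* R)) (s≤s z≤n) ⟩
  R ℕ.* R ℕ.+ 3 ℕ.* (R ℕ.* R)  ≡⟨⟩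
  4 ℕ.* (R ℕ.* R)             ∎))
  where open ℕP.≤-Reasoning

pell-root-bound : ∀ p r → + 4 * (p * p) ≡ + 1 + + 3 * (r * r) → ∣ p ∣ ℕ.≤ ∣ r ∣
pell-root-bound p r eq = 4P²≡1+3R²⇒P≤R ∣ p ∣ ∣ r ∣ (ℤP.+-injective (begin
  + (4 ℕ.* (∣ p ∣ ℕ.* ∣ p ∣))        ≡⟨ ℤP.pos-* 4 (∣ p ∣ ℕ.* ∣ p ∣) ⟩
  + 4 * + (∣ p ∣ ℕ.* ∣ p ∣)          ≡⟨ cong (+ 4 *_) (i*i≡+∣i∣*∣i∣ p) ⟨
  + 4 * (p * p)                    ≡⟨ eq ⟩
  + 1 + + 3 * (r * r)              ≡⟨ cong (λ t → + 1 + + 3 * t) (i*i≡+∣i∣*∣i∣ r) ⟩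
  + 1 + + 3 * + (∣ r ∣ ℕ.* ∣ r ∣)    ≡⟨ cong (λ t → + 1 + t) (ℤP.pos-* 3 (∣ r ∣ ℕ.* ∣ r ∣)) ⟨
  + (1 ℕ.+ 3 ℕ.* (∣ r ∣ ℕ.* ∣ r ∣))  ∎))
  where open ≡-Reasoning

4ce≤2r⇒e≡0 : ∀ {c e r} k → c ≢ 0 → e ≡ k ℕ.* r → 4 ℕ.* (c ℕ.* e) ℕ.≤ 2 ℕ.* r → e ≡ 0
4ce≤2r⇒e≡0 {e = zero}        _         _   _    _      = refl
4ce≤2r⇒e≡0 {e = suc _} {r}   zero      _   ()   _
4ce≤2r⇒e≡0 {c} {e@(suc _)} {r} k@(suc _) c≢0 e≡kr 4ce≤2r = ⊥-elim (ℕP.<-irrefl refl (begin-strict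
  2 ℕ.* e          <⟨ ℕP.*-monoˡ-< e {2} {4} (s≤s (s≤s (s≤s z≤n))) ⟩
  4 ℕ.* e          ≤⟨ ℕP.*-monoʳ-≤ 4 (ℕP.m≤n*m e c {{ℕ.≢-nonZero c≢0}}) ⟩
  4 ℕ.* (c ℕ.* e)  ≤⟨ 4ce≤2r ⟩
  2 ℕ.* r          ≤⟨ ℕP.*-monoʳ-≤ 2 (ℕP.≤-trans (ℕP.m≤n*m r k) (ℕP.≤-reflexive (sym e≡kr))) ⟩
  2 ℕ.* e          ∎))
  where open ℕP.≤-Reasoning

-- Gaussian integers

scale : ℤ → ℤ[i] → ℤ[i]
scale k u = (k * re u) + (k * im u) i

lit-⊛ : ∀ k u → lit k ⊛ u ≡ scale k u
lit-⊛ k u = cong₂ _+_i (ℤP.+-identityʳ (k * re u)) (ℤP.+-identityʳ (k * im u))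

ι-⊛ : ∀ a b → ι a ⊛ ι b ≡ ι (a * b)
ι-⊛ a b = cong₂ _+_i (ℤP.+-identityʳ (a * b)) (trans (ℤP.+-identityʳ (a * + 0)) (ℤP.*-zeroʳ a))

rational : ∀ {u} → im u ≡ + 0 → u ≡ ι (re u)
rational {u} = cong (λ t → re u + t i)

im-ι⊛ : ∀ a u → im (ι a ⊛ u) ≡ a * im u
im-ι⊛ a u = ℤP.+-identityʳ (a * im u)

rational-factor : ∀ a u → a ≢ + 0 → im (ι a ⊛ u) ≡ + 0 → im u ≡ + 0
rational-factor a u a≢0 eq with ℤP.i*j≡0⇒i≡0∨j≡0 a (trans (sym (im-ι⊛ a u)) eq)
... | inj₁ a≡0 = ⊥-elim (a≢0 a≡0)
... | inj₂ im-u≡0 = im-u≡0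

im-⊛ι : ∀ u a → im (u ⊛ ι a) ≡ im u * a
im-⊛ι u a = trans (cong (_+ im u * a) (ℤP.*-zeroʳ (re u))) (ℤP.+-identityˡ (im u * a))

⊖1≡0⇒≡1 : ∀ u → u ⊖ 1ᵍ ≡ 0ᵍ → u ≡ 1ᵍ
⊖1≡0⇒≡1 _ eq = cong₂ _+_i (ℤP.i-j≡0⇒i≡j _ _ (cong re eq)) (ℤP.i-j≡0⇒i≡j _ _ (cong im eq))

⊖⊕-cancel : ∀ u w → u ≡ (u ⊖ w) ⊕ w
⊖⊕-cancel u w = cong₂ _+_i (i≡i-j+j (re u) (re w)) (i≡i-j+j (im u) (im w))

norm : ℤ[i] → ℤ
norm u = re u * re u + im u * im u

norm-⊛ : ∀ u w → norm (u ⊛ w) ≡ norm u * norm w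
norm-⊛ u w = two-squares (re u) (im u) (re w) (im w)
  where
  two-squares : ∀ a b c d → (a * c - b * d) * (a * c - b * d) + (a * d + b * c) * (a * d + b * c)
                            ≡ (a * a + b * b) * (c * c + d * d)
  two-squares = solve-∀

∣norm∣ : ∀ u → ∣ norm u ∣ ≡ ∣ re u ∣ ℕ.* ∣ re u ∣ ℕ.+ ∣ im u ∣ ℕ.* ∣ im u ∣
∣norm∣ u = cong ∣_∣ (cong₂ _+_ (i*i≡+∣i∣*∣i∣ (re u)) (i*i≡+∣i∣*∣i∣ (im u)))

∣norm∣≢0 : ∀ {u} → u ≢ 0ᵍ → ∣ norm u ∣ ≢ 0
∣norm∣≢0 {u} u≢0 ∣Nu∣≡0 = u≢0 (cong₂ _+_i (vanish (re u) (ℕP.m+n≡0⇒m≡0 _ Nu≡0)) (vanish (im u) (ℕP.m+n≡0⇒n≡0 _ Nu≡0)))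
  where
  Nu≡0 : ∣ re u ∣ ℕ.* ∣ re u ∣ ℕ.+ ∣ im u ∣ ℕ.* ∣ im u ∣ ≡ 0
  Nu≡0 = trans (sym (∣norm∣ u)) ∣Nu∣≡0
  vanish : ∀ j → ∣ j ∣ ℕ.* ∣ j ∣ ≡ 0 → j ≡ + 0
  vanish j = ℤP.∣i∣≡0⇒i≡0 ∘′ m*m≡0⇒m≡0

⊛-≢0 : ∀ u w → u ≢ 0ᵍ → w ≢ 0ᵍ → u ⊛ w ≢ 0ᵍ
⊛-≢0 u w u≢0 w≢0 uw≡0 with ℕP.m*n≡0⇒m≡0∨n≡0 ∣ norm u ∣
  (trans (sym (ℤP.abs-* (norm u) (norm w))) (cong ∣_∣ (trans (sym (norm-⊛ u w)) (cong norm uw≡0))))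
... | inj₁ ∣Nu∣≡0 = ∣norm∣≢0 u≢0 ∣Nu∣≡0
... | inj₂ ∣Nw∣≡0 = ∣norm∣≢0 w≢0 ∣Nw∣≡0

∣im∣≤∣rational-multiple∣ : ∀ w u g → w ≢ 0ᵍ → w ⊛ u ≡ ι g → ∣ im u ∣ ℕ.≤ ∣ g ∣
∣im∣≤∣rational-multiple∣ w u g w≢0 wu≡g = m*m≤n*n⇒m≤n (begin
  ∣ im u ∣ ℕ.* ∣ im u ∣                        ≤⟨ ℕP.m≤n+m _ (∣ re u ∣ ℕ.* ∣ re u ∣) ⟩
  ∣ re u ∣ ℕ.* ∣ re u ∣ ℕ.+ ∣ im u ∣ ℕ.* ∣ im u ∣ ≡⟨ ∣norm∣ u ⟨
  ∣ norm u ∣                                  ≤⟨ ℕP.m≤n*m ∣ norm u ∣ ∣ norm w ∣ {{ℕ.≢-nonZero (∣norm∣≢0 w≢0)}} ⟩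
  ∣ norm w ∣ ℕ.* ∣ norm u ∣                     ≡⟨ ℤP.abs-* (norm w) (norm u) ⟨
  ∣ norm w * norm u ∣                          ≡⟨ cong ∣_∣ (norm-⊛ w u) ⟨
  ∣ norm (w ⊛ u) ∣                             ≡⟨ cong (∣_∣ ∘′ norm) wu≡g ⟩
  ∣ norm (ι g) ∣                               ≡⟨ trans (∣norm∣ (ι g)) (ℕP.+-identityʳ _) ⟩
  ∣ g ∣ ℕ.* ∣ g ∣                               ∎)
  where open ℕP.≤-Reasoning

-- Pell equations u² − δw² = s over ℤ[i]

twistedNorm : ℤ → ℤ[i] → ℤ[i] → ℤ
twistedNorm δ u w = norm u - δ * norm w

twistedNorm-identity : ∀ δ u w →
  twistedNorm δ u w * twistedNorm δ u w + + 4 * δ * ((im u * re w - re u * im w) * (im u * re w - re u * im w))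
  ≡ norm (sq u ⊖ scale δ (sq w))
twistedNorm-identity δ u w = identity δ (re u) (im u) (re w) (im w)
  where
  identity : ∀ δ a b c d →
    (a * a + b * b - δ * (c * c + d * d)) * (a * a + b * b - δ * (c * c + d * d)) + + 4 * δ * ((b * c - a * d) * (b * c - a * d))
    ≡ (a * a - b * b - δ * (c * c - d * d)) * (a * a - b * b - δ * (c * c - d * d))
      + (a * b + b * a - δ * (c * d + d * c)) * (a * b + b * a - δ * (c * d + d * c))
  identity = solve-∀

module _ {p : ℕ} (p-prime : Prime p) {u w : ℤ[i]} {s : ℤ} (eq : sq u ⊖ scale (+ p) (sq w) ≡ ι s) where

  ∣twistedNorm∣²≡∣s∣² : ∣ s ∣ ℕ.≤ 1 → ∣ twistedNorm (+ p) u w ∣ ℕ.* ∣ twistedNorm (+ p) u w ∣ ≡ ∣ s ∣ ℕ.* ∣ s ∣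
  ∣twistedNorm∣²≡∣s∣² ∣s∣≤1 = sq+c*sq≡t≤1⇒ {i = tw} {j = q} {c = 4 ℕ.* p} 2≤4p (ℕP.*-mono-≤ ∣s∣≤1 ∣s∣≤1) (begin
    tw * tw + + (4 ℕ.* p) * (q * q)   ≡⟨ cong (λ c → tw * tw + c * (q * q)) (ℤP.pos-* 4 p) ⟩
    tw * tw + + 4 * + p * (q * q)     ≡⟨ twistedNorm-identity (+ p) u w ⟩
    norm (sq u ⊖ scale (+ p) (sq w))  ≡⟨ cong norm eq ⟩
    s * s + + 0 * + 0                 ≡⟨ ℤP.+-identityʳ (s * s) ⟩
    s * s                             ≡⟨ i*i≡+∣i∣*∣i∣ s ⟩
    + (∣ s ∣ ℕ.* ∣ s ∣)                ∎)
    where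
    open ≡-Reasoning
    tw q : ℤ
    tw = twistedNorm (+ p) u w
    q = im u * re w - re u * im w
    2≤4p : 2 ℕ.≤ 4 ℕ.* p
    2≤4p = ℕP.≤-trans (s≤s (s≤s z≤n)) (ℕP.m≤m*n 4 p {{prime⇒nonZero p-prime}})

  twistedNorm≡s⇒im≡0 : twistedNorm (+ p) u w ≡ s → im u ≡ + 0 × im w ≡ + 0
  twistedNorm≡s⇒im≡0 tw≡s = sq≡prime*sq⇒≡0ℤ p-prime (ℤP.i-j≡0⇒i≡j _ _ (2*i≡0⇒i≡0 (begin
    + 2 * (im u * im u - + p * (im w * im w))                ≡⟨ difference (+ p) (re u) (im u) (re w) (im w) ⟨
    twistedNorm (+ p) u w - re (sq u ⊖ scale (+ p) (sq w))   ≡⟨ cong₂ _-_ tw≡s (cong re eq) ⟩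
    s - s                                                    ≡⟨ ℤP.+-inverseʳ s ⟩
    + 0                                                      ∎)))
    where
    open ≡-Reasoning
    difference : ∀ δ a b c d → a * a + b * b - δ * (c * c + d * d) - (a * a - b * b - δ * (c * c - d * d))
                               ≡ + 2 * (b * b - δ * (d * d))
    difference = solve-∀

  twistedNorm≡-s⇒re≡0 : twistedNorm (+ p) u w ≡ - s → re u ≡ + 0 × re w ≡ + 0
  twistedNorm≡-s⇒re≡0 tw≡-s = sq≡prime*sq⇒≡0ℤ p-prime (ℤP.i-j≡0⇒i≡j _ _ (2*i≡0⇒i≡0 (begin
    + 2 * (re u * re u - + p * (re w * re w))                ≡⟨ total (+ p) (re u) (im u) (re w) (im w) ⟨
    twistedNorm (+ p) u w + re (sq u ⊖ scale (+ p) (sq w))   ≡⟨ cong₂ _+_ tw≡-s (cong re eq) ⟩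
    - s + s                                                  ≡⟨ ℤP.+-inverseˡ s ⟩
    + 0                                                      ∎)))
    where
    open ≡-Reasoning
    total : ∀ δ a b c d → a * a + b * b - δ * (c * c + d * d) + (a * a - b * b - δ * (c * c - d * d))
                          ≡ + 2 * (a * a - δ * (c * c))
    total = solve-∀

rotate : ℤ[i] → ℤ[i]
rotate u = (- im u) + re u i

-- A² + 2B² = A² − 2(iB)², a Pell equation of norm 0.
sq+2*sq≡0⇒≡0 : ∀ A B → sq A ⊕ lit (+ 2) ⊛ sq B ≡ 0ᵍ → A ≡ 0ᵍ × B ≡ 0ᵍ
sq+2*sq≡0⇒≡0 A B eq =
  cong₂ _+_i (proj₁ re≡0) (proj₁ im≡0) ,
  cong₂ _+_i (proj₂ im≡0) (ℤP.neg-injective (proj₂ re≡0))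
  where
  re-part : ∀ x c d → x + + 2 * (c * c - d * d) ≡ x - + 2 * (- d * - d - c * c)
  re-part = solve-∀
  im-part : ∀ x c d → x + + 2 * (c * d + d * c) ≡ x - + 2 * (- d * c + c * - d)
  im-part = solve-∀
  eq′ : sq A ⊖ scale (+ 2) (sq (rotate B)) ≡ 0ᵍ
  eq′ = begin
    sq A ⊖ scale (+ 2) (sq (rotate B))  ≡⟨ cong₂ _+_i (re-part (re (sq A)) (re B) (im B)) (im-part (im (sq A)) (re B) (im B)) ⟨
    sq A ⊕ scale (+ 2) (sq B)           ≡⟨ cong (sq A ⊕_) (lit-⊛ (+ 2) (sq B)) ⟨
    sq A ⊕ lit (+ 2) ⊛ sq B             ≡⟨ eq ⟩
    0ᵍ                                  ∎
    where open ≡-Reasoning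
  tw≡0 : twistedNorm (+ 2) A (rotate B) ≡ + 0
  tw≡0 = ℤP.∣i∣≡0⇒i≡0 (m*m≡0⇒m≡0 (∣twistedNorm∣²≡∣s∣² prime[2] {A} {rotate B} eq′ z≤n))
  im≡0 : im A ≡ + 0 × im (rotate B) ≡ + 0
  im≡0 = twistedNorm≡s⇒im≡0 prime[2] {A} {rotate B} eq′ tw≡0
  re≡0 : re A ≡ + 0 × re (rotate B) ≡ + 0
  re≡0 = twistedNorm≡-s⇒re≡0 prime[2] {A} {rotate B} eq′ tw≡0

∣i∣≡1⇒i≡±1 : ∀ {i} → ∣ i ∣ ≡ 1 → i ≡ + 1 ⊎ i ≡ - + 1
∣i∣≡1⇒i≡±1 {+ .1}       refl = inj₁ refl
∣i∣≡1⇒i≡±1 { -[1+ .0 ]} refl = inj₂ refl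

-- The twisted norm is ±1; the sign −1 would make u and w purely imaginary, i.e. 3d² − b² = 1.
pell3⇒rational : ∀ u w → sq u ⊖ scale (+ 3) (sq w) ≡ 1ᵍ → im u ≡ + 0 × im w ≡ + 0
pell3⇒rational u w eq with ∣i∣≡1⇒i≡±1 (ℕP.m*n≡1⇒m≡1 _ _ (∣twistedNorm∣²≡∣s∣² prime[3] {u} {w} eq ℕP.≤-refl))
... | inj₁ tw≡1  = twistedNorm≡s⇒im≡0 prime[3] {u} {w} eq tw≡1
... | inj₂ tw≡-1 = ⊥-elim (3*sq-sq≢1 (im u) (im w) (trans (sym (imaginary (im u) (im w))) purely-imaginary))
  where
  re≡0 : re u ≡ + 0 × re w ≡ + 0
  re≡0 = twistedNorm≡-s⇒re≡0 prime[3] {u} {w} eq tw≡-1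
  imaginary : ∀ b d → + 0 * + 0 - b * b - + 3 * (+ 0 * + 0 - d * d) ≡ + 3 * (d * d) - b * b
  imaginary = solve-∀
  purely-imaginary : + 0 * + 0 - im u * im u - + 3 * (+ 0 * + 0 - im w * im w) ≡ + 1
  purely-imaginary = subst₂ (λ a c → a * a - im u * im u - + 3 * (c * c - im w * im w) ≡ + 1)
    (proj₁ re≡0) (proj₂ re≡0) (cong re eq)

-- From a solution to a rational integer

N : ℤ[i] → ℤ[i]
N z = lit (+ 2) ⊛ z ⊕ 1ᵍ

M : ℤ[i] → ℤ[i]
M z = lit (+ 2) ⊛ sq (N z) ⊕ 1ᵍ

pell₁ : ℤ[i] → ℤ[i] → ℤ[i] → ℤ[i]
pell₁ z v y = lit (+ 4) ⊛ sq (lit (+ 2) ⊛ v ⊛ M z ⊖ y) ⊖ lit (+ 3) ⊛ sq y ⊖ 1ᵍ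

pell₂ : ℤ[i] → ℤ[i] → ℤ[i] → ℤ[i] → ℤ[i]
pell₂ z w x y = sq w ⊖ 1ᵍ ⊖ lit (+ 3) ⊛ sq y ⊛ sq (N z ⊖ x ⊛ y)

pell≡0⇒P≡0 : ∀ z v w x y → pell₁ z v y ≡ 0ᵍ → pell₂ z w x y ≡ 0ᵍ → P z v w x y ≡ 0ᵍ
pell≡0⇒P≡0 z v w x y = cong₂ (λ A B → sq A ⊕ lit (+ 2) ⊛ sq B)

re-N : ∀ z → re (N z) ≡ + 2 * re z + + 1
re-N z = cong (_+ + 1) (ℤP.+-identityʳ (+ 2 * re z))

im-N : ∀ z → im (N z) ≡ + 2 * im z
im-N z = trans (ℤP.+-identityʳ (+ 2 * im z + + 0)) (ℤP.+-identityʳ (+ 2 * im z))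

im-M : ∀ z → im (M z) ≡ + 4 * (re (N z) * im (N z))
im-M z = identity (re (N z)) (im (N z))
  where
  identity : ∀ c d → + 2 * (c * d + d * c) + + 0 + + 0 ≡ + 4 * (c * d)
  identity = solve-∀

scale4-sq : ∀ u → scale (+ 4) (sq u) ≡ sq (scale (+ 2) u)
scale4-sq u = cong₂ _+_i (re-part (re u) (im u)) (im-part (re u) (im u))
  where
  re-part : ∀ a b → + 4 * (a * a - b * b) ≡ + 2 * a * (+ 2 * a) - + 2 * b * (+ 2 * b)
  re-part = solve-∀
  im-part : ∀ a b → + 4 * (a * b + b * a) ≡ + 2 * a * (+ 2 * b) + + 2 * b * (+ 2 * a)
  im-part = solve-∀

scale-⊛ : ∀ k u w → scale k u ⊛ w ≡ scale k (u ⊛ w)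
scale-⊛ k u w = cong₂ _+_i (re-part k (re u) (im u) (re w) (im w)) (im-part k (re u) (im u) (re w) (im w))
  where
  re-part : ∀ k a b c d → k * a * c - k * b * d ≡ k * (a * c - b * d)
  re-part = solve-∀
  im-part : ∀ k a b c d → k * a * d + k * b * c ≡ k * (a * d + b * c)
  im-part = solve-∀

sq-⊛ : ∀ u w → sq u ⊛ sq w ≡ sq (u ⊛ w)
sq-⊛ u w = cong₂ _+_i (re-part (re u) (im u) (re w) (im w)) (im-part (re u) (im u) (re w) (im w))
  where
  re-part : ∀ a b c d → (a * a - b * b) * (c * c - d * d) - (a * b + b * a) * (c * d + d * c)
                        ≡ (a * c - b * d) * (a * c - b * d) - (a * d + b * c) * (a * d + b * c)
  re-part = solve-∀
  im-part : ∀ a b c d → (a * a - b * b) * (c * d + d * c) + (a * b + b * a) * (c * c - d * d)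
                        ≡ (a * c - b * d) * (a * d + b * c) + (a * d + b * c) * (a * c - b * d)
  im-part = solve-∀

⊖-swap : ∀ u v w → u ⊖ v ⊖ w ≡ u ⊖ w ⊖ v
⊖-swap u v w = cong₂ _+_i (swap (re u) (re v) (re w)) (swap (im u) (im v) (im w))
  where
  swap : ∀ a b c → a - b - c ≡ a - c - b
  swap = solve-∀

pell₁-as-pell3 : ∀ u y → lit (+ 4) ⊛ sq u ⊖ lit (+ 3) ⊛ sq y ⊖ 1ᵍ ≡ sq (scale (+ 2) u) ⊖ scale (+ 3) (sq y) ⊖ 1ᵍ
pell₁-as-pell3 u y =
  cong₂ (λ s t → s ⊖ t ⊖ 1ᵍ) (trans (lit-⊛ (+ 4) (sq u)) (scale4-sq u)) (lit-⊛ (+ 3) (sq y))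

pell₂-as-pell3 : ∀ w y t → sq w ⊖ 1ᵍ ⊖ lit (+ 3) ⊛ sq y ⊛ sq t ≡ sq w ⊖ scale (+ 3) (sq (y ⊛ t)) ⊖ 1ᵍ
pell₂-as-pell3 w y t = begin
  sq w ⊖ 1ᵍ ⊖ lit (+ 3) ⊛ sq y ⊛ sq t        ≡⟨ cong (λ s → sq w ⊖ 1ᵍ ⊖ s ⊛ sq t) (lit-⊛ (+ 3) (sq y)) ⟩
  sq w ⊖ 1ᵍ ⊖ scale (+ 3) (sq y) ⊛ sq t      ≡⟨ cong (λ s → sq w ⊖ 1ᵍ ⊖ s) (scale-⊛ (+ 3) (sq y) (sq t)) ⟩
  sq w ⊖ 1ᵍ ⊖ scale (+ 3) (sq y ⊛ sq t)      ≡⟨ cong (λ s → sq w ⊖ 1ᵍ ⊖ scale (+ 3) s) (sq-⊛ y t) ⟩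
  sq w ⊖ 1ᵍ ⊖ scale (+ 3) (sq (y ⊛ t))       ≡⟨ ⊖-swap (sq w) 1ᵍ (scale (+ 3) (sq (y ⊛ t))) ⟩
  sq w ⊖ scale (+ 3) (sq (y ⊛ t)) ⊖ 1ᵍ       ∎
  where open ≡-Reasoning

lit-⊛-sq-ι : ∀ k a → lit k ⊛ sq (ι a) ≡ ι (k * (a * a))
lit-⊛-sq-ι k a = trans (cong (lit k ⊛_) (ι-⊛ a a)) (ι-⊛ k (a * a))

-- ∣Im M∣ = 4 ∣Re(2z + 1)∣ ∣Im(2z + 1)∣ exceeds 2∣r∣ ≥ 2∣Im(2z + 1)∣ unless Im(2z + 1) = 0.
small-rational-multiple⇒im≡0 : ∀ z v x g r → v ≢ 0ᵍ → lit (+ 2) ⊛ v ⊛ M z ≡ ι g →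
                               ∣ g ∣ ℕ.≤ 2 ℕ.* ∣ r ∣ → im (N z) ≡ im x * r → im z ≡ + 0
small-rational-multiple⇒im≡0 z v x g r v≢0 2vM≡ιg ∣g∣≤2∣r∣ imN≡imx*r =
  2*i≡0⇒i≡0 (trans (sym (im-N z)) (ℤP.∣i∣≡0⇒i≡0 (4ce≤2r⇒e≡0 ∣ im x ∣ ∣reN∣≢0 ∣imN∣≡∣imx∣∣r∣ 4∣reN∣∣imN∣≤2∣r∣)))
  where
  ∣imN∣≡∣imx∣∣r∣ : ∣ im (N z) ∣ ≡ ∣ im x ∣ ℕ.* ∣ r ∣
  ∣imN∣≡∣imx∣∣r∣ = trans (cong ∣_∣ imN≡imx*r) (ℤP.abs-* (im x) r)
  ∣reN∣≢0 : ∣ re (N z) ∣ ≢ 0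
  ∣reN∣≢0 ∣reN∣≡0 = 2j+1≢0 (re z) (trans (sym (re-N z)) (ℤP.∣i∣≡0⇒i≡0 ∣reN∣≡0))
  4∣reN∣∣imN∣≤2∣r∣ : 4 ℕ.* (∣ re (N z) ∣ ℕ.* ∣ im (N z) ∣) ℕ.≤ 2 ℕ.* ∣ r ∣
  4∣reN∣∣imN∣≤2∣r∣ = begin
    4 ℕ.* (∣ re (N z) ∣ ℕ.* ∣ im (N z) ∣)  ≡⟨ cong (4 ℕ.*_) (ℤP.abs-* (re (N z)) (im (N z))) ⟨
    4 ℕ.* ∣ re (N z) * im (N z) ∣         ≡⟨ ℤP.abs-* (+ 4) (re (N z) * im (N z)) ⟨
    ∣ + 4 * (re (N z) * im (N z)) ∣       ≡⟨ cong ∣_∣ (im-M z) ⟨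
    ∣ im (M z) ∣                          ≤⟨ ∣im∣≤∣rational-multiple∣ (lit (+ 2) ⊛ v) (M z) g (⊛-≢0 (lit (+ 2)) v (λ ()) v≢0) 2vM≡ιg ⟩
    ∣ g ∣                                 ≤⟨ ∣g∣≤2∣r∣ ⟩
    2 ℕ.* ∣ r ∣                           ∎
    where open ℕP.≤-Reasoning

solution⇒im≡0 : ∀ {z v w x y} → v ≢ 0ᵍ → P z v w x y ≡ 0ᵍ → im z ≡ + 0
solution⇒im≡0 {z} {v} {w} {x} {y} v≢0 P≡0 =
  small-rational-multiple⇒im≡0 z v x (p + r) r v≢0 2vM≡ι[p+r] ∣p+r∣≤2∣r∣ imN≡imx*r
  where
  U T : ℤ[i]
  U = lit (+ 2) ⊛ v ⊛ M z ⊖ y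
  T = N z ⊖ x ⊛ y
  pell₁≡0 : pell₁ z v y ≡ 0ᵍ
  pell₁≡0 = proj₁ (sq+2*sq≡0⇒≡0 (pell₁ z v y) (pell₂ z w x y) P≡0)
  pell₂≡0 : pell₂ z w x y ≡ 0ᵍ
  pell₂≡0 = proj₂ (sq+2*sq≡0⇒≡0 (pell₁ z v y) (pell₂ z w x y) P≡0)
  2U,y-rational : im (scale (+ 2) U) ≡ + 0 × im y ≡ + 0
  2U,y-rational = pell3⇒rational (scale (+ 2) U) y (⊖1≡0⇒≡1 _ (trans (sym (pell₁-as-pell3 U y)) pell₁≡0))
  yT-rational : im (y ⊛ T) ≡ + 0
  yT-rational = proj₂ (pell3⇒rational w (y ⊛ T) (⊖1≡0⇒≡1 _ (trans (sym (pell₂-as-pell3 w y T)) pell₂≡0)))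
  p r : ℤ
  p = re U
  r = re y
  U≡ιp : U ≡ ι p
  U≡ιp = rational (2*i≡0⇒i≡0 (proj₁ 2U,y-rational))
  y≡ιr : y ≡ ι r
  y≡ιr = rational (proj₂ 2U,y-rational)
  pell₁-rational : ι (+ 4 * (p * p) - + 3 * (r * r) - + 1) ≡ 0ᵍ
  pell₁-rational = begin
    ι (+ 4 * (p * p) - + 3 * (r * r) - + 1)             ≡⟨ cong₂ (λ s t → s ⊖ t ⊖ 1ᵍ) (lit-⊛-sq-ι (+ 4) p) (lit-⊛-sq-ι (+ 3) r) ⟨
    lit (+ 4) ⊛ sq (ι p) ⊖ lit (+ 3) ⊛ sq (ι r) ⊖ 1ᵍ  ≡⟨ cong₂ (λ s t → lit (+ 4) ⊛ sq s ⊖ lit (+ 3) ⊛ sq t ⊖ 1ᵍ) U≡ιp y≡ιr ⟨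
    pell₁ z v y                                        ≡⟨ pell₁≡0 ⟩
    0ᵍ                                                 ∎
    where open ≡-Reasoning
  pell : + 4 * (p * p) ≡ + 1 + + 3 * (r * r)
  pell = trans (i≡i-j+j (+ 4 * (p * p)) (+ 3 * (r * r)))
    (cong (_+ + 3 * (r * r)) (ℤP.i-j≡0⇒i≡j (+ 4 * (p * p) - + 3 * (r * r)) (+ 1) (cong re pell₁-rational)))
  r≢0 : r ≢ + 0
  r≢0 r≡0 = 4j≢1 (p * p) (subst (λ t → + 4 * (p * p) ≡ + 1 + + 3 * (t * t)) r≡0 pell)
  imN≡imx*r : im (N z) ≡ im x * r
  imN≡imx*r = begin
    im (N z)      ≡⟨ ℤP.i-j≡0⇒i≡j _ _ (rational-factor r T r≢0 (subst (λ t → im (t ⊛ T) ≡ + 0) y≡ιr yT-rational)) ⟩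
    im (x ⊛ y)    ≡⟨ cong (λ t → im (x ⊛ t)) y≡ιr ⟩
    im (x ⊛ ι r)  ≡⟨ im-⊛ι x r ⟩
    im x * r      ∎
    where open ≡-Reasoning
  2vM≡ι[p+r] : lit (+ 2) ⊛ v ⊛ M z ≡ ι (p + r)
  2vM≡ι[p+r] = trans (⊖⊕-cancel _ y) (cong₂ _⊕_ U≡ιp y≡ιr)
  ∣p+r∣≤2∣r∣ : ∣ p + r ∣ ℕ.≤ 2 ℕ.* ∣ r ∣
  ∣p+r∣≤2∣r∣ = begin
    ∣ p + r ∣         ≤⟨ ℤP.∣i+j∣≤∣i∣+∣j∣ p r ⟩
    ∣ p ∣ ℕ.+ ∣ r ∣    ≤⟨ ℕP.+-monoˡ-≤ ∣ r ∣ (pell-root-bound p r pell) ⟩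
    ∣ r ∣ ℕ.+ ∣ r ∣    ≡⟨ cong (∣ r ∣ ℕ.+_) (ℕP.+-identityʳ ∣ r ∣) ⟨
    2 ℕ.* ∣ r ∣       ∎
    where open ℕP.≤-Reasoning

-- Congruences and the ring ℤ[√3]

infix 4 _≡_mod_

record _≡_mod_ (a b m : ℤ) : Set where
  constructor ≡-mod
  field
    divides-difference : m ∣ a - b

module _ {m : ℤ} where

  ≡-mod-refl : ∀ a → a ≡ a mod m
  ≡-mod-refl a = ≡-mod (divides (+ 0) (ℤP.+-inverseʳ a))

  ≡-mod-sym : ∀ {a b} → a ≡ b mod m → b ≡ a mod m
  ≡-mod-sym {a} {b} (≡-mod m∣a-b) = ≡-mod (subst (m ∣_) (identity a b) (∣m⇒∣-m m∣a-b))
    where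
    identity : ∀ a b → - (a - b) ≡ b - a
    identity = solve-∀

  ≡-mod-trans : ∀ {a b c} → a ≡ b mod m → b ≡ c mod m → a ≡ c mod m
  ≡-mod-trans {a} {b} {c} (≡-mod m∣a-b) (≡-mod m∣b-c) =
    ≡-mod (subst (m ∣_) (identity a b c) (∣m∣n⇒∣m+n m∣a-b m∣b-c))
    where
    identity : ∀ a b c → a - b + (b - c) ≡ a - c
    identity = solve-∀

  ≡-mod-+ : ∀ {a b c d} → a ≡ b mod m → c ≡ d mod m → a + c ≡ b + d mod m
  ≡-mod-+ {a} {b} {c} {d} (≡-mod m∣a-b) (≡-mod m∣c-d) =
    ≡-mod (subst (m ∣_) (identity a b c d) (∣m∣n⇒∣m+n m∣a-b m∣c-d))
    where
    identity : ∀ a b c d → a - b + (c - d) ≡ a + c - (b + d)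
    identity = solve-∀

  ≡-mod-* : ∀ {a b c d} → a ≡ b mod m → c ≡ d mod m → a * c ≡ b * d mod m
  ≡-mod-* {a} {b} {c} {d} (≡-mod m∣a-b) (≡-mod m∣c-d) =
    ≡-mod (subst (m ∣_) (identity a b c d) (∣m∣n⇒∣m+n (∣m⇒∣m*n d m∣a-b) (∣n⇒∣m*n a m∣c-d)))
    where
    identity : ∀ a b c d → (a - b) * d + a * (c - d) ≡ a * c - b * d
    identity = solve-∀

-- The summand c * (n − 1) lets a polynomial identity for the witness use the hypothesis n = 1.
≡-mod-from-witness : ∀ {a b m n} q c → a - b ≡ q * m + c * (n - + 1) → n ≡ + 1 → a ≡ b mod m
≡-mod-from-witness {m = m} q c eq refl =
  ≡-mod (divides q (trans eq (trans (cong (λ t → q * m + t) (ℤP.*-zeroʳ c)) (ℤP.+-identityʳ (q * m)))))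

infix 6 _+_√3
infixl 7 _·_

record ℤ[√3] : Set where
  constructor _+_√3
  field
    rat irr : ℤ
open ℤ[√3]

_·_ : ℤ[√3] → ℤ[√3] → ℤ[√3]
u · v = (rat u * rat v + + 3 * (irr u * irr v)) + (rat u * irr v + irr u * rat v) √3

conj : ℤ[√3] → ℤ[√3]
conj u = rat u + (- irr u) √3

pellNorm : ℤ[√3] → ℤ
pellNorm u = rat u * rat u - + 3 * (irr u * irr u)

one ε : ℤ[√3]
one = _+_√3 (+ 1) (+ 0)
ε   = _+_√3 (+ 2) (+ 1)

_^_ : ℤ[√3] → ℕ → ℤ[√3]
u ^ zero  = one
u ^ suc k = u · u ^ k

·-assoc : ∀ u v w → u · v · w ≡ u · (v · w)
·-assoc u v w = cong₂ _+_√3 (rat-part (rat u) (irr u) (rat v) (irr v) (rat w) (irr w))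
                            (irr-part (rat u) (irr u) (rat v) (irr v) (rat w) (irr w))
  where
  rat-part : ∀ a b c d e f → (a * c + + 3 * (b * d)) * e + + 3 * ((a * d + b * c) * f)
                             ≡ a * (c * e + + 3 * (d * f)) + + 3 * (b * (c * f + d * e))
  rat-part = solve-∀
  irr-part : ∀ a b c d e f → (a * c + + 3 * (b * d)) * f + (a * d + b * c) * e
                             ≡ a * (c * f + d * e) + b * (c * e + + 3 * (d * f))
  irr-part = solve-∀

·-identityˡ : ∀ u → one · u ≡ u
·-identityˡ u = cong₂ _+_√3 (rat-part (rat u) (irr u)) (irr-part (rat u) (irr u))
  where
  rat-part : ∀ a b → + 1 * a + + 3 * (+ 0 * b) ≡ a
  rat-part = solve-∀
  irr-part : ∀ a b → + 1 * b + + 0 * a ≡ b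
  irr-part = solve-∀

·-identityʳ : ∀ u → u · one ≡ u
·-identityʳ u = cong₂ _+_√3 (rat-part (rat u) (irr u)) (irr-part (rat u) (irr u))
  where
  rat-part : ∀ a b → a * + 1 + + 3 * (b * + 0) ≡ a
  rat-part = solve-∀
  irr-part : ∀ a b → a * + 0 + b * + 1 ≡ b
  irr-part = solve-∀

·-conj : ∀ u → u · conj u ≡ _+_√3 (pellNorm u) (+ 0)
·-conj u = cong₂ _+_√3 (rat-part (rat u) (irr u)) (irr-part (rat u) (irr u))
  where
  rat-part : ∀ a b → a * a + + 3 * (b * - b) ≡ a * a - + 3 * (b * b)
  rat-part = solve-∀
  irr-part : ∀ a b → a * - b + b * a ≡ + 0
  irr-part = solve-∀

pellNorm-· : ∀ u v → pellNorm (u · v) ≡ pellNorm u * pellNorm v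
pellNorm-· u v = brahmagupta (rat u) (irr u) (rat v) (irr v)
  where
  brahmagupta : ∀ a b c d →
    (a * c + + 3 * (b * d)) * (a * c + + 3 * (b * d)) - + 3 * ((a * d + b * c) * (a * d + b * c))
    ≡ (a * a - + 3 * (b * b)) * (c * c - + 3 * (d * d))
  brahmagupta = solve-∀

pellNorm-^ : ∀ u k → pellNorm u ≡ + 1 → pellNorm (u ^ k) ≡ + 1
pellNorm-^ u zero    _    = refl
pellNorm-^ u (suc k) N≡1 = trans (pellNorm-· u (u ^ k)) (cong₂ _*_ N≡1 (pellNorm-^ u k N≡1))

^-+ : ∀ u m n → u ^ (m ℕ.+ n) ≡ u ^ m · u ^ n
^-+ u zero    n = sym (·-identityˡ (u ^ n))
^-+ u (suc m) n = trans (cong (u ·_) (^-+ u m n)) (sym (·-assoc u (u ^ m) (u ^ n)))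

infix 4 _≅_mod_

_≅_mod_ : ℤ[√3] → ℤ[√3] → ℤ → Set
u ≅ v mod m = rat u ≡ rat v mod m × irr u ≡ irr v mod m

module _ {m : ℤ} where

  ≅-refl : ∀ u → u ≅ u mod m
  ≅-refl u = ≡-mod-refl (rat u) , ≡-mod-refl (irr u)

  ≅-reflexive : ∀ {u v} → u ≡ v → u ≅ v mod m
  ≅-reflexive {u} refl = ≅-refl u

  ≅-sym : ∀ {u v} → u ≅ v mod m → v ≅ u mod m
  ≅-sym (r , s) = ≡-mod-sym r , ≡-mod-sym s

  ≅-trans : ∀ {u v w} → u ≅ v mod m → v ≅ w mod m → u ≅ w mod m
  ≅-trans (r , s) (r′ , s′) = ≡-mod-trans r r′ , ≡-mod-trans s s′

  ·-cong : ∀ {u u′ v v′} → u ≅ u′ mod m → v ≅ v′ mod m → u · v ≅ u′ · v′ mod m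
  ·-cong (a≡ , b≡) (c≡ , d≡) =
    ≡-mod-+ (≡-mod-* a≡ c≡) (≡-mod-* (≡-mod-refl (+ 3)) (≡-mod-* b≡ d≡)) ,
    ≡-mod-+ (≡-mod-* a≡ d≡) (≡-mod-* b≡ c≡)

≅-setoid : ℤ → Setoid 0ℓ 0ℓ
≅-setoid m = record
  { Carrier       = ℤ[√3]
  ; _≈_           = _≅_mod m
  ; isEquivalence = record { refl = ≅-refl _ ; sym = ≅-sym ; trans = ≅-trans }
  }

≅-mod-∣ : ∀ {m k u v} → m ∣ k → u ≅ v mod k → u ≅ v mod m
≅-mod-∣ m∣k (≡-mod r , ≡-mod s) = ≡-mod (∣-trans m∣k r) , ≡-mod (∣-trans m∣k s)

unit-cancel : ∀ {m} u w → pellNorm w ≡ + 1 → u · w ≅ w mod m → u ≅ one mod m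
unit-cancel {m} u w Nw≡1 uw≅w = begin
  u                  ≡⟨ ·-identityʳ u ⟨
  u · one            ≡⟨ cong (u ·_) w·w̄≡1 ⟨
  u · (w · conj w)   ≡⟨ ·-assoc u w (conj w) ⟨
  u · w · conj w     ≈⟨ ·-cong uw≅w (≅-refl (conj w)) ⟩
  w · conj w         ≡⟨ w·w̄≡1 ⟩
  one                ∎
  where
  open SetoidReasoning (≅-setoid m)
  w·w̄≡1 : w · conj w ≡ one
  w·w̄≡1 = trans (·-conj w) (cong (λ n → _+_√3 n (+ 0)) Nw≡1)

^-odd : ∀ {m} u d → u ^ d ≅ one mod m → u ^ suc (d ℕ.+ d) ≅ u mod m
^-odd {m} u d uᵈ≅1 = begin
  u · u ^ (d ℕ.+ d)      ≡⟨ cong (u ·_) (^-+ u d d) ⟩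
  u · (u ^ d · u ^ d)    ≈⟨ ·-cong (≅-refl u) (·-cong uᵈ≅1 uᵈ≅1) ⟩
  u · one                ≡⟨ ·-identityʳ u ⟩
  u                      ∎
  where open SetoidReasoning (≅-setoid m)

module _ (K : ℕ) .{{_ : NonZero K}} where

  residue : ℤ → Fin K
  residue a = fromℕ< (n%ℕd<d a K)

  same-residue⇒≡-mod : ∀ a b → residue a ≡ residue b → a ≡ b mod + K
  same-residue⇒≡-mod a b same = ≡-mod (divides (a /ℕ K - b /ℕ K) (begin
    a - b                                                      ≡⟨ cong₂ _-_ (a≡a%ℕn+[a/ℕn]*n a K) (a≡a%ℕn+[a/ℕn]*n b K) ⟩
    (+ (a %ℕ K) + a /ℕ K * + K) - (+ (b %ℕ K) + b /ℕ K * + K)   ≡⟨ cong (λ r → (+ (a %ℕ K) + a /ℕ K * + K) - (+ r + b /ℕ K * + K)) a%K≡b%K ⟨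
    (+ (a %ℕ K) + a /ℕ K * + K) - (+ (a %ℕ K) + b /ℕ K * + K)   ≡⟨ cancel (+ (a %ℕ K)) (a /ℕ K) (b /ℕ K) (+ K) ⟩
    (a /ℕ K - b /ℕ K) * + K                                    ∎))
    where
    open ≡-Reasoning
    a%K≡b%K : a %ℕ K ≡ b %ℕ K
    a%K≡b%K = trans (sym (toℕ-fromℕ< _)) (trans (cong toℕ same) (toℕ-fromℕ< _))
    cancel : ∀ r q q′ k → r + q * k - (r + q′ * k) ≡ (q - q′) * k
    cancel = solve-∀

  residue² : ℤ[√3] → Fin (K ℕ.* K)
  residue² u = combine (residue (rat u)) (residue (irr u))

  same-residue²⇒≅ : ∀ u v → residue² u ≡ residue² v → u ≅ v mod + K
  same-residue²⇒≅ u v same = let r , s = combine-injective _ _ _ _ same in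
    same-residue⇒≡-mod (rat u) (rat v) r , same-residue⇒≡-mod (irr u) (irr v) s

  -- Two of the residues of ε⁰, …, ε^(K²) coincide, and ε is a unit.  Opaque, because unfolding
  -- the pigeonhole witness in later definitions is prohibitively expensive.
  opaque
    ε-periodic : ∃[ d ] ε ^ suc d ≅ one mod + K
    ε-periodic with s , t , s<t , same ← pigeonhole (ℕP.n<1+n (K ℕ.* K)) (λ k → residue² (ε ^ toℕ k))
      with d , s+1+d≡t ← ℕP.m≤n⇒∃[o]m+o≡n s<t
      = d , unit-cancel (ε ^ suc d) (ε ^ toℕ s) (pellNorm-^ ε (toℕ s) refl) (begin
        ε ^ suc d · ε ^ toℕ s     ≡⟨ ^-+ ε (suc d) (toℕ s) ⟨
        ε ^ (suc d ℕ.+ toℕ s)     ≡⟨ cong (ε ^_) (trans (cong suc (ℕP.+-comm d (toℕ s))) s+1+d≡t) ⟩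
        ε ^ toℕ t                 ≈⟨ same-residue²⇒≅ (ε ^ toℕ t) (ε ^ toℕ s) (sym same) ⟩
        ε ^ toℕ s                 ∎)
      where open SetoidReasoning (≅-setoid (+ K))

ε^-positive : ∀ n → + 0 ℤ.< rat (ε ^ n) × + 0 ℤ.≤ irr (ε ^ n)
ε^-positive zero    = ℤ.+<+ (s≤s z≤n) , ℤ.+≤+ z≤n
ε^-positive (suc n) with 0<a , 0≤b ← ε^-positive n =
  ℤP.+-mono-<-≤ (ℤP.*-monoˡ-<-pos (+ 2) 0<a) (ℤP.*-monoˡ-≤-nonNeg (+ 3) (ℤP.*-monoˡ-≤-nonNeg (+ 1) 0≤b)) ,
  ℤP.<⇒≤ (ℤP.+-mono-≤-< (ℤP.*-monoˡ-≤-nonNeg (+ 2) 0≤b) (ℤP.*-monoˡ-<-pos (+ 1) 0<a))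

irr-ε^suc-positive : ∀ n → + 0 ℤ.< irr (ε ^ suc n)
irr-ε^suc-positive n with 0<a , 0≤b ← ε^-positive n =
  ℤP.+-mono-≤-< (ℤP.*-monoˡ-≤-nonNeg (+ 2) 0≤b) (ℤP.*-monoˡ-<-pos (+ 1) 0<a)

-- rat (ε w) − 2 irr (ε w) = − irr w.
rat-ε^≢2irr : ∀ n → rat (ε ^ suc (suc n)) ≢ + 2 * irr (ε ^ suc (suc n))
rat-ε^≢2irr n eq = ℤP.<-irrefl (sym irr≡0) (irr-ε^suc-positive n)
  where
  shift : ∀ c d → + 2 * c + + 3 * (+ 1 * d) - + 2 * (+ 2 * d + + 1 * c) ≡ - d
  shift = solve-∀
  w : ℤ[√3]
  w = ε ^ suc n
  irr≡0 : irr w ≡ + 0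
  irr≡0 = ℤP.neg-injective (trans (sym (shift (rat w) (irr w))) (ℤP.i≡j⇒i-j≡0 eq))

pell-solution≅ε : ∀ m → m ≢ + 0 → ∃[ η ] pellNorm η ≡ + 1 × η ≅ ε mod m × rat η ≢ + 2 * irr η
pell-solution≅ε m m≢0 with d , εᵈ⁺¹≅1 ← ε-periodic ∣ m ∣ {{ℤ.≢-nonZero m≢0}} =
  ε ^ suc (suc d ℕ.+ suc d) ,
  pellNorm-^ ε (suc (suc d ℕ.+ suc d)) refl ,
  ≅-mod-∣ m∣∣m∣ (^-odd ε (suc d) εᵈ⁺¹≅1) ,
  rat-ε^≢2irr (d ℕ.+ suc d)

-- Modulo Y², η² ≡ 1 + 2XY√3 since X² = 1 + 3Y², so each multiplication by η² adds 2Y√3.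
odd-step : ∀ X Y j → pellNorm (X + Y √3) ≡ + 1 →
           (X + Y √3) · ((X + Y √3) · (X + j * Y √3)) ≅ X + (+ 2 + j) * Y √3 mod Y * Y
odd-step X Y j N≡1 =
  ≡-mod-from-witness ((+ 6 * j + + 6) * X) X (rat-step X Y j) N≡1 ,
  ≡-mod-from-witness ((+ 6 * j + + 6) * Y) ((+ 2 + j) * Y) (irr-step X Y j) N≡1
  where
  rat-step : ∀ X Y j → X * (X * X + + 3 * (Y * (j * Y))) + + 3 * (Y * (X * (j * Y) + Y * X)) - X
                       ≡ (+ 6 * j + + 6) * X * (Y * Y) + X * (X * X - + 3 * (Y * Y) - + 1)
  rat-step = solve-∀
  irr-step : ∀ X Y j → X * (X * (j * Y) + Y * X) + Y * (X * X + + 3 * (Y * (j * Y))) - (+ 2 + j) * Y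
                       ≡ (+ 6 * j + + 6) * Y * (Y * Y) + (+ 2 + j) * Y * (X * X - + 3 * (Y * Y) - + 1)
  irr-step = solve-∀

odd-powers : ∀ X Y → pellNorm (X + Y √3) ≡ + 1 →
             ∀ t → (X + Y √3) ^ suc (t ℕ.+ t) ≅ X + + suc (t ℕ.+ t) * Y √3 mod Y * Y
odd-powers X Y N≡1 zero = ≅-reflexive (trans (·-identityʳ (X + Y √3)) (cong (_+_√3 X) (sym (ℤP.*-identityˡ Y))))
odd-powers X Y N≡1 (suc t) rewrite ℕP.+-suc t t =
  ≅-trans (·-cong (≅-refl η) (·-cong (≅-refl η) (odd-powers X Y N≡1 t))) (odd-step X Y (+ suc (t ℕ.+ t)) N≡1)
  where η = X + Y √3

-- From a rational integer to a solution

Nℤ : ℤ → ℤ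
Nℤ a = + 2 * a + + 1

Mℤ : ℤ → ℤ
Mℤ a = + 2 * (Nℤ a * Nℤ a) + + 1

pell₁ℤ : ℤ → ℤ → ℤ → ℤ
pell₁ℤ a v y = + 4 * ((+ 2 * v * Mℤ a - y) * (+ 2 * v * Mℤ a - y)) - + 3 * (y * y) - + 1

pell₂ℤ : ℤ → ℤ → ℤ → ℤ → ℤ
pell₂ℤ a w x y = w * w - + 1 - + 3 * (y * y) * ((Nℤ a - x * y) * (Nℤ a - x * y))

N-ι : ∀ a → N (ι a) ≡ ι (Nℤ a)
N-ι a = cong (_⊕ 1ᵍ) (ι-⊛ (+ 2) a)

M-ι : ∀ a → M (ι a) ≡ ι (Mℤ a)
M-ι a = begin
  lit (+ 2) ⊛ sq (N (ι a)) ⊕ 1ᵍ      ≡⟨ cong (λ t → lit (+ 2) ⊛ sq t ⊕ 1ᵍ) (N-ι a) ⟩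
  lit (+ 2) ⊛ sq (ι (Nℤ a)) ⊕ 1ᵍ     ≡⟨ cong (_⊕ 1ᵍ) (lit-⊛-sq-ι (+ 2) (Nℤ a)) ⟩
  ι (Mℤ a)                           ∎
  where open ≡-Reasoning

pell₁-ι : ∀ a v y → pell₁ (ι a) (ι v) (ι y) ≡ ι (pell₁ℤ a v y)
pell₁-ι a v y = begin
  lit (+ 4) ⊛ sq (lit (+ 2) ⊛ ι v ⊛ M (ι a) ⊖ ι y) ⊖ lit (+ 3) ⊛ sq (ι y) ⊖ 1ᵍ
    ≡⟨ cong (λ t → lit (+ 4) ⊛ sq (t ⊖ ι y) ⊖ lit (+ 3) ⊛ sq (ι y) ⊖ 1ᵍ) 2vM-ι ⟩
  lit (+ 4) ⊛ sq (ι (+ 2 * v * Mℤ a - y)) ⊖ lit (+ 3) ⊛ sq (ι y) ⊖ 1ᵍ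
    ≡⟨ cong₂ (λ s t → s ⊖ t ⊖ 1ᵍ) (lit-⊛-sq-ι (+ 4) (+ 2 * v * Mℤ a - y)) (lit-⊛-sq-ι (+ 3) y) ⟩
  ι (pell₁ℤ a v y)
    ∎
  where
  open ≡-Reasoning
  2vM-ι : lit (+ 2) ⊛ ι v ⊛ M (ι a) ≡ ι (+ 2 * v * Mℤ a)
  2vM-ι = trans (cong₂ _⊛_ (ι-⊛ (+ 2) v) (M-ι a)) (ι-⊛ (+ 2 * v) (Mℤ a))

pell₂-ι : ∀ a w x y → pell₂ (ι a) (ι w) (ι x) (ι y) ≡ ι (pell₂ℤ a w x y)
pell₂-ι a w x y = begin
  sq (ι w) ⊖ 1ᵍ ⊖ lit (+ 3) ⊛ sq (ι y) ⊛ sq (N (ι a) ⊖ ι x ⊛ ι y)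
    ≡⟨ cong₂ (λ s t → sq (ι w) ⊖ 1ᵍ ⊖ lit (+ 3) ⊛ sq (ι y) ⊛ sq (s ⊖ t)) (N-ι a) (ι-⊛ x y) ⟩
  sq (ι w) ⊖ 1ᵍ ⊖ lit (+ 3) ⊛ sq (ι y) ⊛ sq (ι t)
    ≡⟨ cong₂ (λ s r → sq (ι w) ⊖ 1ᵍ ⊖ s ⊛ r) (lit-⊛-sq-ι (+ 3) y) (ι-⊛ t t) ⟩
  sq (ι w) ⊖ 1ᵍ ⊖ ι (+ 3 * (y * y)) ⊛ ι (t * t)
    ≡⟨ cong₂ (λ s r → s ⊖ 1ᵍ ⊖ r) (ι-⊛ w w) (ι-⊛ (+ 3 * (y * y)) (t * t)) ⟩
  ι (pell₂ℤ a w x y)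
    ∎
  where
  open ≡-Reasoning
  t : ℤ
  t = Nℤ a - x * y

Nℤ-+ : ∀ t → Nℤ (+ t) ≡ + suc (t ℕ.+ t)
Nℤ-+ t = trans (cong (_+ + 1) (sym (ℤP.pos-* 2 t))) (cong +_ (2t+1 t))
  where
  2t+1 : ∀ t → 2 ℕ.* t ℕ.+ 1 ≡ suc (t ℕ.+ t)
  2t+1 = ℕ-Solver.solve-∀

Nℤ-odd : ∀ a → ∃[ t ] (Nℤ a ≡ + suc (t ℕ.+ t) ⊎ Nℤ a ≡ - + suc (t ℕ.+ t))
Nℤ-odd (+ t)    = t , inj₁ (Nℤ-+ t)
Nℤ-odd -[1+ t ] = t , inj₂ (trans (negate (+ t)) (cong -_ (Nℤ-+ t)))
  where
  negate : ∀ s → + 2 * - (+ 1 + s) + + 1 ≡ - (+ 2 * s + + 1)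
  negate = solve-∀

4M≢0 : ∀ a → + 4 * Mℤ a ≢ + 0
4M≢0 a 4M≡0 with ℤP.i*j≡0⇒i≡0∨j≡0 (+ 4) 4M≡0
... | inj₂ M≡0 = 2j+1≢0 (Nℤ a * Nℤ a) M≡0

pell₁-solution : ∀ a η → pellNorm η ≡ + 1 → η ≅ ε mod (+ 4 * Mℤ a) → rat η ≢ + 2 * irr η →
                 ∃[ v ] v ≢ + 0 × pell₁ (ι a) (ι v) (ι (- irr η)) ≡ 0ᵍ
pell₁-solution a η N≡1 (≡-mod (divides qx X-2≡) , ≡-mod (divides qy Y-1≡)) X≢2Y = v , v≢0 , (begin
  pell₁ (ι a) (ι v) (ι (- Y))                       ≡⟨ pell₁-ι a v (- Y) ⟩
  ι (pell₁ℤ a v (- Y))                              ≡⟨ cong (λ t → ι (pell₁ℤ a v (- t))) Y≡ ⟩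
  ι (pell₁ℤ a v (- (qy * K + + 1)))                 ≡⟨ cong ι (substituted (Mℤ a) qx qy) ⟩
  ι (pellNorm ((qx * K + + 2) + (qy * K + + 1) √3) - + 1)
                                                    ≡⟨ cong₂ (λ s t → ι (pellNorm (s + t √3) - + 1)) X≡ Y≡ ⟨
  ι (pellNorm η - + 1)                              ≡⟨ cong (λ n → ι (n - + 1)) N≡1 ⟩
  0ᵍ                                                ∎)
  where
  open ≡-Reasoning
  X Y K v : ℤ
  X = rat η
  Y = irr η
  K = + 4 * Mℤ a
  v = qx - + 2 * qy
  X≡ : X ≡ qx * K + + 2
  X≡ = trans (i≡i-j+j X (+ 2)) (cong (_+ + 2) X-2≡)
  Y≡ : Y ≡ qy * K + + 1
  Y≡ = trans (i≡i-j+j Y (+ 1)) (cong (_+ + 1) Y-1≡)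
  -- 2(2vM + Y) = vK + 2Y = X, as K = 4M.
  substituted : ∀ m qx qy →
    + 4 * ((+ 2 * (qx - + 2 * qy) * m - - (qy * (+ 4 * m) + + 1)) * (+ 2 * (qx - + 2 * qy) * m - - (qy * (+ 4 * m) + + 1)))
      - + 3 * (- (qy * (+ 4 * m) + + 1) * - (qy * (+ 4 * m) + + 1)) - + 1
    ≡ (qx * (+ 4 * m) + + 2) * (qx * (+ 4 * m) + + 2) - + 3 * ((qy * (+ 4 * m) + + 1) * (qy * (+ 4 * m) + + 1)) - + 1
  substituted = solve-∀
  doubled : ∀ q k → + 2 * q * k + + 2 ≡ + 2 * (q * k + + 1)
  doubled = solve-∀
  v≢0 : v ≢ + 0
  v≢0 v≡0 = X≢2Y (begin
    X                    ≡⟨ X≡ ⟩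
    qx * K + + 2         ≡⟨ cong (λ q → q * K + + 2) (ℤP.i-j≡0⇒i≡j qx (+ 2 * qy) v≡0) ⟩
    + 2 * qy * K + + 2   ≡⟨ doubled qy K ⟩
    + 2 * (qy * K + + 1) ≡⟨ cong (+ 2 *_) Y≡ ⟨
    + 2 * Y              ∎)

pell₂-ι≡0 : ∀ a w x y b → w * w - + 3 * (b * b) ≡ + 1 →
            (y * (Nℤ a - x * y)) * (y * (Nℤ a - x * y)) ≡ b * b → pell₂ (ι a) (ι w) (ι x) (ι y) ≡ 0ᵍ
pell₂-ι≡0 a w x y b pell yT²≡b² = begin
  pell₂ (ι a) (ι w) (ι x) (ι y)                                       ≡⟨ pell₂-ι a w x y ⟩
  ι (pell₂ℤ a w x y)                                                  ≡⟨ cong ι (regroup (Nℤ a) w x y) ⟩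
  ι (w * w - + 3 * ((y * (Nℤ a - x * y)) * (y * (Nℤ a - x * y))) - + 1) ≡⟨ cong (λ t → ι (w * w - + 3 * t - + 1)) yT²≡b² ⟩
  ι (w * w - + 3 * (b * b) - + 1)                                     ≡⟨ cong (λ n → ι (n - + 1)) pell ⟩
  0ᵍ                                                                  ∎
  where
  open ≡-Reasoning
  regroup : ∀ n w x y → w * w - + 1 - + 3 * (y * y) * ((n - x * y) * (n - x * y))
                        ≡ w * w - + 3 * ((y * (n - x * y)) * (y * (n - x * y))) - + 1
  regroup = solve-∀

-- With ηᵏ = A + B√3 and B = kY + qY² (k odd, ∣ 2a + 1 ∣ = k), take w = A, x = ±q, y = −Y.
pell₂-solution : ∀ a η → pellNorm η ≡ + 1 → ∃[ w ] ∃[ x ] pell₂ (ι a) (ι w) (ι x) (ι (- irr η)) ≡ 0ᵍ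
pell₂-solution a η N≡1 with t , n≡±k ← Nℤ-odd a
  with ≡-mod (divides q B-kY≡) ← proj₂ (odd-powers (rat η) (irr η) N≡1 t) = solution n≡±k
  where
  Y k : ℤ
  Y = irr η
  k = + suc (t ℕ.+ t)
  ηᵏ : ℤ[√3]
  ηᵏ = η ^ suc (t ℕ.+ t)
  B≡ : irr ηᵏ ≡ q * (Y * Y) + k * Y
  B≡ = trans (i≡i-j+j (irr ηᵏ) (k * Y)) (cong (_+ k * Y) B-kY≡)
  pell : rat ηᵏ * rat ηᵏ - + 3 * (irr ηᵏ * irr ηᵏ) ≡ + 1
  pell = pellNorm-^ η (suc (t ℕ.+ t)) N≡1
  square₊ : ∀ Y q k → (- Y * (k - q * - Y)) * (- Y * (k - q * - Y)) ≡ (q * (Y * Y) + k * Y) * (q * (Y * Y) + k * Y)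
  square₊ = solve-∀
  square₋ : ∀ Y q k → (- Y * (- k - - q * - Y)) * (- Y * (- k - - q * - Y)) ≡ (q * (Y * Y) + k * Y) * (q * (Y * Y) + k * Y)
  square₋ = solve-∀
  solution : Nℤ a ≡ k ⊎ Nℤ a ≡ - k → ∃[ w ] ∃[ x ] pell₂ (ι a) (ι w) (ι x) (ι (- Y)) ≡ 0ᵍ
  solution (inj₁ n≡k)  = rat ηᵏ , q , pell₂-ι≡0 a (rat ηᵏ) q (- Y) (irr ηᵏ) pell (begin
    (- Y * (Nℤ a - q * - Y)) * (- Y * (Nℤ a - q * - Y))  ≡⟨ cong (λ n → (- Y * (n - q * - Y)) * (- Y * (n - q * - Y))) n≡k ⟩
    (- Y * (k - q * - Y)) * (- Y * (k - q * - Y))        ≡⟨ square₊ Y q k ⟩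
    (q * (Y * Y) + k * Y) * (q * (Y * Y) + k * Y)        ≡⟨ cong (λ b → b * b) B≡ ⟨
    irr ηᵏ * irr ηᵏ                                      ∎)
    where open ≡-Reasoning
  solution (inj₂ n≡-k) = rat ηᵏ , - q , pell₂-ι≡0 a (rat ηᵏ) (- q) (- Y) (irr ηᵏ) pell (begin
    (- Y * (Nℤ a - - q * - Y)) * (- Y * (Nℤ a - - q * - Y))  ≡⟨ cong (λ n → (- Y * (n - - q * - Y)) * (- Y * (n - - q * - Y))) n≡-k ⟩
    (- Y * (- k - - q * - Y)) * (- Y * (- k - - q * - Y))    ≡⟨ square₋ Y q k ⟩
    (q * (Y * Y) + k * Y) * (q * (Y * Y) + k * Y)            ≡⟨ cong (λ b → b * b) B≡ ⟨
    irr ηᵏ * irr ηᵏ                                          ∎)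
    where open ≡-Reasoning

rational⇒solution : ∀ a → ∃[ v ] ∃[ w ] ∃[ x ] ∃[ y ] (v ≢ 0ᵍ × P (ι a) v w x y ≡ 0ᵍ)
rational⇒solution a = from-pell (pell-solution≅ε (+ 4 * Mℤ a) (4M≢0 a))
  where
  from-pell : ∃[ η ] pellNorm η ≡ + 1 × η ≅ ε mod (+ 4 * Mℤ a) × rat η ≢ + 2 * irr η →
              ∃[ v ] ∃[ w ] ∃[ x ] ∃[ y ] (v ≢ 0ᵍ × P (ι a) v w x y ≡ 0ᵍ)
  from-pell (η , N≡1 , η≅ε , X≢2Y) = assemble (pell₁-solution a η N≡1 η≅ε X≢2Y) (pell₂-solution a η N≡1)
    where
    assemble : ∃[ v ] v ≢ + 0 × pell₁ (ι a) (ι v) (ι (- irr η)) ≡ 0ᵍ →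
               ∃[ w ] ∃[ x ] pell₂ (ι a) (ι w) (ι x) (ι (- irr η)) ≡ 0ᵍ →
               ∃[ v ] ∃[ w ] ∃[ x ] ∃[ y ] (v ≢ 0ᵍ × P (ι a) v w x y ≡ 0ᵍ)
    assemble (v , v≢0 , pell₁≡0) (w , x , pell₂≡0) =
      ι v , ι w , ι x , ι (- irr η) , v≢0 ∘′ cong re ,
      pell≡0⇒P≡0 (ι a) (ι v) (ι w) (ι x) (ι (- irr η)) pell₁≡0 pell₂≡0

theorem1p1 : (z : ℤ[i]) → IsRationalInteger z ⇔ (∃[ v ] ∃[ w ] ∃[ x ] ∃[ y ] (v ≢ 0ᵍ × P z v w x y ≡ 0ᵍ))
theorem1p1 z = mk⇔ forward backward
  where
  Solvable : ℤ[i] → Set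
  Solvable t = ∃[ v ] ∃[ w ] ∃[ x ] ∃[ y ] (v ≢ 0ᵍ × P t v w x y ≡ 0ᵍ)
  forward : IsRationalInteger z → Solvable z
  forward (a , z≡ιa) = subst Solvable (sym z≡ιa) (rational⇒solution a)
  backward : Solvable z → IsRationalInteger z
  backward (v , w , x , y , v≢0 , P≡0) = re z , rational (solution⇒im≡0 {z} {v} {w} {x} {y} v≢0 P≡0)
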